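{- The natural numbers that do not appear in the sequence $(a(n))_{n\ge 0}$ are precisely the numbers $\lfloor \varphi^2 k+\tfrac12\rfloor$ for integers $k\ge 1$.
   Context: $\varphi=(1+\sqrt5)/2$. Fibonacci numbers: $F_0=0$, $F_1=1$, $F_n=F_{n-1}+F_{n-2}$. The sequence $(a(n))_{n\geq 0}$ (OEIS A105774) is defined by $a(n)=n$ for $n\le 1$, and $a(n)=F_{j+1}-a(n-F_j)$ if $F_j<n\le F_{j+1}$ with $j\ge 2$. -}

module Defs where

open import Data.Nat using (ℕ; zero; suc; _+_; _*_; _∸_; _≤_; _<_; _≤?_)
open import Data.Product using (_×_)
open import Data.Sum using (_⊎_)
open import Relation.Nullary.Decidable using (does)
open import Data.Bool using (if_then_else_)

F : ℕ → ℕ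
F zero = 0
F (suc zero) = 1
F (suc (suc n)) = F (suc n) + F n

-- findJ fuel j n : the least j' ≥ j with n ≤ F (j'+1) (search bounded by fuel).
-- For n ≥ 2, findJ n 2 n is the unique j ≥ 2 with F j < n ≤ F (j+1).
findJ : ℕ → ℕ → ℕ → ℕ
findJ zero j n = j
findJ (suc fuel) j n = if does (n ≤? F (suc j)) then j else findJ fuel (suc j) n

-- a with fuel (fuel ≥ n+1 suffices since n - F j < n)
aF : ℕ → ℕ → ℕ
aF zero n = 0
aF (suc f) zero = 0
aF (suc f) (suc zero) = 1
aF (suc f) (suc (suc m)) =
  let n = suc (suc m)
      j = findJ n 2 n
  in F (suc j) ∸ aF f (n ∸ F j)

-- OEIS A105774: a n = n for n ≤ 1, a n = F (j+1) - a (n - F j) for F j < n ≤ F (j+1), j ≥ 2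
a : ℕ → ℕ
a n = aF (suc n) n

-- m ≡ ⌊ φ² k + 1/2 ⌋, with φ² = (3 + √5)/2, written out as the defining
-- inequalities m ≤ φ² k + 1/2 < m + 1, i.e.
--   2m - 3k - 1 ≤ √5 k   and   √5 k < 2m + 1 - 3k,
-- with the comparisons against √5 k (≥ 0) expressed by squaring.
IsFloorPhi²k+½ : ℕ → ℕ → Set
IsFloorPhi²k+½ k m =
  (2 * m ≤ 3 * k + 1 ⊎ (2 * m ∸ (3 * k + 1)) * (2 * m ∸ (3 * k + 1)) ≤ 5 * (k * k))
  × (3 * k < 2 * m + 1 × 5 * (k * k) < (2 * m + 1 ∸ 3 * k) * (2 * m + 1 ∸ 3 * k))

module Submission where

-- On the block F (i + 2) < n ≤ F (i + 3) the sequence is n ↦ F (i + 3) - a (n - F (i + 2)),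
-- so it takes values in [F (i + 2), F (i + 3)), never takes the values F (i + 4) (i ≥ 0), and
-- for F (i + 3) < m < F (i + 4) it takes the value m iff it takes F (i + 4) - m.
-- The numbers m = ⌊φ² k + ½⌋ behave the same way: F (i + 4) is one (take k = F (i + 2)), and
-- k ↦ F (i + 2) - k turns witnesses for m into witnesses for F (i + 4) - m and back.
-- With f = F (i + 2), p = F (i + 1), L = f + 2 p and ε = L - f √5, Cassini's identity gives
-- ε ε̄ = ±4, and 2 φ² (f - k) = 2 F (i + 4) - ε - 2 φ² k; so the reflection can only fail if
-- 2 φ² k = (3 + √5) k lies strictly between an odd integer y and y - ε.  Multiplying that small
-- gap by ε̄ gives an element of ℤ[√5] which, together with its conjugate, lies in (0, 4) and has
-- even coordinate sum; it must be 2, forcing y = F (i + 4), which is impossible in the block.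
-- All inequalities are decided exactly in ℤ[√5].  Strong induction on m then proves the claim.

open import Defs

module Irrationality where

  open import Data.Nat using (zero; suc; _*_; _<_; z≤n; s≤s)
  open import Data.Nat.Properties using (*-comm; *-cancelˡ-≡; m<m*n)
  open import Data.Nat.Divisibility using (_∣_; divides)
  open import Data.Nat.Primality using (prime?; euclidsLemma)
  open import Data.Nat.Induction using (<-rec)
  open import Data.Nat.Tactic.RingSolver using (solve)
  open import Data.List using (_∷_; [])
  open import Data.Product using (∃-syntax; _×_; _,_)
  open import Data.Sum using ([_,_]′)
  open import Function using (id)
  open import Relation.Nullary.Decidable using (from-yes)
  open import Relation.Binary.PropositionalEquality

  5∣x²⇒5∣x : ∀ x → 5 ∣ x * x → 5 ∣ x
  5∣x²⇒5∣x x 5∣x² = [ id , id ]′ (euclidsLemma x x (from-yes (prime? 5)) 5∣x²)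

  x²≡5y²-descent : ∀ x y → x * x ≡ 5 * (y * y) → ∃[ q ] x ≡ q * 5 × y * y ≡ 5 * (q * q)
  x²≡5y²-descent x y x²≡5y² with 5∣x²⇒5∣x x (divides (y * y) (trans x²≡5y² (*-comm 5 (y * y))))
  ... | divides q refl =
    q , refl , *-cancelˡ-≡ (y * y) (5 * (q * q)) 5 (trans (sym x²≡5y²) (solve (q ∷ [])))

  x²≡5y²⇒y≡0 : ∀ x y → x * x ≡ 5 * (y * y) → y ≡ 0
  x²≡5y²⇒y≡0 = <-rec _ descent
    where
    descent : ∀ x → (∀ {z} → z < x → ∀ y → z * z ≡ 5 * (y * y) → y ≡ 0) →
              ∀ y → x * x ≡ 5 * (y * y) → y ≡ 0
    descent zero _ zero _ = refl
    descent zero _ (suc y) ()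
    descent (suc x) rec y x²≡5y² with x²≡5y²-descent (suc x) y x²≡5y²
    ... | zero , () , _
    ... | q@(suc _) , x≡q5 , y²≡5q² with x²≡5y²-descent y q y²≡5q²
    ...   | r , y≡r5 , q²≡5r² = trans y≡r5 (cong (_* 5) (rec q<x r q²≡5r²))
      where
      q<x : q < suc x
      q<x = subst (q <_) (sym x≡q5) (m<m*n q 5 (s≤s (s≤s z≤n)))

module IntegerOrder where

  import Data.Nat.Properties as ℕ
  open import Data.Nat using (zero; suc; z≤n; s≤s)
  open import Data.Integer
    using (ℤ; +_; +0; +[1+_]; -[1+_]; 0ℤ; 1ℤ; _+_; _*_; -_; _-_; _<_; _≤_; +<+; +≤+)
  open import Data.Integer.Properties
    using ( +-mono-<; +-monoˡ-<; +-mono-<-≤; +-inverseʳ; +-identityˡ; *-zeroʳ; pos-*; neg-involutive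
          ; neg-mono-<; *-cancelˡ-<-nonNeg; *-monoˡ-≤-nonNeg; <-asym; ≤-<-trans; <⇒≤; _≟_ )
  open import Data.Integer.Tactic.RingSolver using (solve)
  open import Data.List using (_∷_; [])
  open import Data.Product using (_×_; _,_)
  open import Data.Empty using (⊥-elim)
  open import Relation.Nullary using (yes; no)
  open import Relation.Binary.PropositionalEquality

  private variable i j p q r s : ℤ

  0<+[1+_] : ∀ n → 0ℤ < +[1+ n ]
  0<+[1+ n ] = +<+ (s≤s z≤n)

  0≤0 : 0ℤ ≤ 0ℤ
  0≤0 = +≤+ z≤n

  0<-≡ : 0ℤ < i → i ≡ j → 0ℤ < j
  0<-≡ 0<i refl = 0<i

  <⇒0<- : i < j → 0ℤ < j - i
  <⇒0<- {i} {j} i<j = subst (_< j - i) (+-inverseʳ i) (+-monoˡ-< (- i) i<j)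

  0<-⇒< : 0ℤ < j - i → i < j
  0<-⇒< {j} {i} 0<j-i = subst₂ _<_ (+-identityˡ i) j-i+i≡j (+-monoˡ-< i 0<j-i)
    where
    j-i+i≡j : j - i + i ≡ j
    j-i+i≡j = solve (i ∷ j ∷ [])

  0<-⇒<0 : 0ℤ < - i → i < 0ℤ
  0<-⇒<0 {i} 0<-i = subst (_< 0ℤ) (neg-involutive i) (neg-mono-< 0<-i)

  0<⇒0≤-1 : 0ℤ < i → 0ℤ ≤ i - 1ℤ
  0<⇒0≤-1 {+[1+ n ]} _ = +≤+ z≤n
  0<⇒0≤-1 {+0} (+<+ ())

  0<* : 0ℤ < i → 0ℤ < j → 0ℤ < i * j
  0<* {+[1+ m ]} {+[1+ n ]} _ _ = 0<+[1+ _ ]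
  0<* {+0} (+<+ ()) _
  0<* {+[1+ m ]} {+0} _ (+<+ ())

  0≤* : 0ℤ ≤ i → 0ℤ ≤ j → 0ℤ ≤ i * j
  0≤* (+≤+ {n = m} _) (+≤+ {n = n} _) = subst (0ℤ ≤_) (pos-* m n) (+≤+ z≤n)

  0≤square : ∀ i → 0ℤ ≤ i * i
  0≤square (+ n) = subst (0ℤ ≤_) (pos-* n n) (+≤+ z≤n)
  0≤square -[1+ n ] = +≤+ z≤n

  0≤5square : ∀ i → 0ℤ ≤ + 5 * (i * i)
  0≤5square i = 0≤* {+ 5} (+≤+ z≤n) (0≤square i)

  1≤square : i ≢ 0ℤ → + 1 ≤ i * i
  1≤square {+0} i≢0 = ⊥-elim (i≢0 refl)
  1≤square {+[1+ n ]} _ = +≤+ (s≤s z≤n)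
  1≤square { -[1+ n ]} _ = +≤+ (s≤s z≤n)

  neg-square : ∀ i → - i * - i ≡ i * i
  neg-square i = solve (i ∷ [])

  0<*∧0<+⇒0< : 0ℤ < i * j → 0ℤ < i + j → 0ℤ < i × 0ℤ < j
  0<*∧0<+⇒0< {+[1+ m ]} {+[1+ n ]} _ _ = 0<+[1+ _ ] , 0<+[1+ _ ]
  0<*∧0<+⇒0< {+0} (+<+ ()) _
  0<*∧0<+⇒0< {+[1+ m ]} {+0} 0<i*0 _ rewrite *-zeroʳ (+[1+ m ]) with 0<i*0
  ... | +<+ ()
  0<*∧0<+⇒0< {+[1+ m ]} { -[1+ n ]} () _
  0<*∧0<+⇒0< { -[1+ m ]} {+0} 0<i*0 _ rewrite *-zeroʳ (-[1+ m ]) with 0<i*0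
  ... | +<+ ()
  0<*∧0<+⇒0< { -[1+ m ]} {+[1+ n ]} () _
  0<*∧0<+⇒0< { -[1+ m ]} { -[1+ n ]} _ ()

  -- p s - q r = (p - q) s + q (s - r)
  gap-product : 0ℤ ≤ q → q < p → 0ℤ ≤ r → r < s → 0ℤ < p * s - q * r
  gap-product {q} {p} {r} {s} 0≤q q<p 0≤r r<s =
    0<-≡ (+-mono-<-≤ (0<* (<⇒0<- q<p) (≤-<-trans 0≤r r<s)) (0≤* 0≤q (<⇒≤ (<⇒0<- r<s))))
         (solve (p ∷ q ∷ r ∷ s ∷ []))

  square-gap : ∀ u v → 0ℤ < u → v * v < u * u → 0ℤ < u - v × 0ℤ < u + v
  square-gap u v 0<u v²<u² = 0<*∧0<+⇒0< {u - v} {u + v}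
    (0<-≡ (<⇒0<- v²<u²) (solve (u ∷ v ∷ []))) (0<-≡ (+-mono-< 0<u 0<u) (solve (u ∷ v ∷ [])))

  20i²<16⇒i≡0 : + 20 * (i * i) < + 16 → i ≡ 0ℤ
  20i²<16⇒i≡0 {i} 20i²<16 with i ≟ 0ℤ
  ... | yes i≡0 = i≡0
  ... | no i≢0 = ⊥-elim (<-asym (≤-<-trans (*-monoˡ-≤-nonNeg (+ 20) (1≤square i≢0)) 20i²<16)
                                (+<+ (ℕ.m<m+n 16 (s≤s z≤n))))

  0<2i<4⇒i≡1 : 0ℤ < + 2 * i → + 2 * i < + 4 → i ≡ + 1
  0<2i<4⇒i≡1 {i} 0<2i 2i<4 =
    0<i<2⇒i≡1 (*-cancelˡ-<-nonNeg {0ℤ} {i} (+ 2) 0<2i) (*-cancelˡ-<-nonNeg {i} {+ 2} (+ 2) 2i<4)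
    where
    0<i<2⇒i≡1 : ∀ {i} → 0ℤ < i → i < + 2 → i ≡ + 1
    0<i<2⇒i≡1 {+[1+ zero ]} _ _ = refl
    0<i<2⇒i≡1 {+[1+ suc n ]} _ (+<+ (s≤s (s≤s ())))
    0<i<2⇒i≡1 {+0} (+<+ ()) _

module QuadraticIntegers where

  import Data.Nat as ℕ
  import Data.Nat.Properties as ℕ
  open import Data.Integer
    using (ℤ; ∣_∣; +_; 0ℤ; _+_; _*_; -_; _-_; _<_; _≤_; +<+)
  open import Data.Integer.Properties
    using ( +-mono-<; +-inverseʳ; +-identityˡ; +-identityʳ; neg-mono-<; *-cancelˡ-<-nonNeg; abs-*
          ; ∣i∣≡0⇒i≡0; <-cmp; <-asym; <-irrefl; <-≤-trans; <⇒≤; i-j≡0⇒i≡j )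
  open import Data.Integer.Tactic.RingSolver using (solve)
  open import Data.List using (_∷_; [])
  open import Data.Product using (_×_; _,_; proj₁; proj₂)
  open import Data.Sum using (_⊎_; inj₁; inj₂)
  open import Data.Empty using (⊥-elim)
  open import Relation.Nullary using (¬_)
  open import Relation.Binary.Definitions using (tri<; tri≈; tri>)
  open import Relation.Binary.PropositionalEquality
  open Irrationality using (x²≡5y²⇒y≡0)
  open IntegerOrder

  infix 6 _+_√5
  data ℤ[√5] : Set where
    _+_√5 : ℤ → ℤ → ℤ[√5]

  re im : ℤ[√5] → ℤ
  re (a + _ √5) = a
  im (_ + b √5) = b

  ι : ℤ → ℤ[√5]
  ι a = a + 0ℤ √5

  0ᴷ : ℤ[√5]
  0ᴷ = ι 0ℤ

  infixl 6 _⊕_ _⊖_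
  infixl 7 _⊗_
  infix 8 ⊝_

  _⊕_ _⊖_ _⊗_ : ℤ[√5] → ℤ[√5] → ℤ[√5]
  (a + b √5) ⊕ (c + d √5) = (a + c) + (b + d) √5
  (a + b √5) ⊖ (c + d √5) = (a - c) + (b - d) √5
  (a + b √5) ⊗ (c + d √5) = (a * c + + 5 * (b * d)) + (a * d + b * c) √5

  ⊝_ conj : ℤ[√5] → ℤ[√5]
  ⊝ (a + b √5) = (- a) + (- b) √5
  conj (a + b √5) = a + (- b) √5

  ≡-by-parts : ∀ {a b c d} → a ≡ c → b ≡ d → a + b √5 ≡ c + d √5
  ≡-by-parts refl refl = refl

  ⊕-comm : ∀ α β → α ⊕ β ≡ β ⊕ α
  ⊕-comm (a + b √5) (c + d √5) = ≡-by-parts (solve (a ∷ c ∷ [])) (solve (b ∷ d ∷ []))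

  ⊗-comm : ∀ α β → α ⊗ β ≡ β ⊗ α
  ⊗-comm (a + b √5) (c + d √5) = ≡-by-parts (solve (a ∷ b ∷ c ∷ d ∷ [])) (solve (a ∷ b ∷ c ∷ d ∷ []))

  ⊗-distribʳ-⊕ : ∀ α β γ → (α ⊕ β) ⊗ γ ≡ α ⊗ γ ⊕ β ⊗ γ
  ⊗-distribʳ-⊕ (a + b √5) (c + d √5) (e + f √5) =
    ≡-by-parts (solve (a ∷ b ∷ c ∷ d ∷ e ∷ f ∷ [])) (solve (a ∷ b ∷ c ∷ d ∷ e ∷ f ∷ []))

  ⊗-distribʳ-⊖ : ∀ α β γ → (α ⊖ β) ⊗ γ ≡ α ⊗ γ ⊖ β ⊗ γ
  ⊗-distribʳ-⊖ (a + b √5) (c + d √5) (e + f √5) =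
    ≡-by-parts (solve (a ∷ b ∷ c ∷ d ∷ e ∷ f ∷ [])) (solve (a ∷ b ∷ c ∷ d ∷ e ∷ f ∷ []))

  ⊝-⊗ : ∀ α β → ⊝ α ⊗ β ≡ ⊝ (α ⊗ β)
  ⊝-⊗ (a + b √5) (c + d √5) = ≡-by-parts (solve (a ∷ b ∷ c ∷ d ∷ [])) (solve (a ∷ b ∷ c ∷ d ∷ []))

  conj-⊗ : ∀ α β → conj (α ⊗ β) ≡ conj α ⊗ conj β
  conj-⊗ (a + b √5) (c + d √5) = ≡-by-parts (solve (a ∷ b ∷ c ∷ d ∷ [])) (solve (a ∷ b ∷ c ∷ d ∷ []))

  ⊖-self : ∀ α → α ⊖ α ≡ 0ᴷ
  ⊖-self (a + b √5) = ≡-by-parts (+-inverseʳ a) (+-inverseʳ b)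

  ⊖-⊕-cancel : ∀ α β → (α ⊖ β) ⊕ β ≡ α
  ⊖-⊕-cancel (a + b √5) (c + d √5) = ≡-by-parts (solve (a ∷ c ∷ [])) (solve (b ∷ d ∷ []))

  -- a + b √5 > 0: its sign is that of a when 5 b² < a² and that of b when a² < 5 b².
  data Positive : ℤ[√5] → Set where
    re-dominant : ∀ {a b} → 0ℤ < a → + 5 * (b * b) < a * a → Positive (a + b √5)
    im-dominant : ∀ {a b} → 0ℤ < b → a * a < + 5 * (b * b) → Positive (a + b √5)

  private variable
    i : ℤ
    α β γ : ℤ[√5]

  Positive-≡ : Positive α → α ≡ β → Positive β
  Positive-≡ α>0 refl = α>0

  ¬positive-0 : ¬ Positive 0ᴷ
  ¬positive-0 (re-dominant (+<+ ()) _)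
  ¬positive-0 (im-dominant (+<+ ()) _)

  ι-positive : Positive (ι i) → 0ℤ < i
  ι-positive (re-dominant 0<i _) = 0<i
  ι-positive (im-dominant (+<+ ()) _)

  positive-asym : Positive α → ¬ Positive (⊝ α)
  positive-asym (re-dominant 0<a _) (re-dominant 0<-a _) = <-asym 0<a (0<-⇒<0 0<-a)
  positive-asym (re-dominant {a} {b} _ 5b²<a²) (im-dominant _ a²<5b²) =
    <-asym 5b²<a² (subst₂ _<_ (neg-square a) (cong (+ 5 *_) (neg-square b)) a²<5b²)
  positive-asym (im-dominant {a} {b} _ a²<5b²) (re-dominant _ 5b²<a²) =
    <-asym a²<5b² (subst₂ _<_ (cong (+ 5 *_) (neg-square b)) (neg-square a) 5b²<a²)
  positive-asym (im-dominant 0<b _) (im-dominant 0<-b _) = <-asym 0<b (0<-⇒<0 0<-b)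

  5b²≡a²⇒0 : ∀ {a b} → + 5 * (b * b) ≡ a * a → a + b √5 ≡ 0ᴷ
  5b²≡a²⇒0 {a} {b} 5b²≡a² = ≡-by-parts (∣i∣≡0⇒i≡0 ∣a∣≡0) (∣i∣≡0⇒i≡0 ∣b∣≡0)
    where
    ∣a∣²≡5∣b∣² : ∣ a ∣ ℕ.* ∣ a ∣ ≡ 5 ℕ.* (∣ b ∣ ℕ.* ∣ b ∣)
    ∣a∣²≡5∣b∣² = trans (sym (abs-* a a))
      (trans (cong ∣_∣ (sym 5b²≡a²)) (trans (abs-* (+ 5) (b * b)) (cong (5 ℕ.*_) (abs-* b b))))
    ∣b∣≡0 : ∣ b ∣ ≡ 0
    ∣b∣≡0 = x²≡5y²⇒y≡0 ∣ a ∣ ∣ b ∣ ∣a∣²≡5∣b∣²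
    ∣a∣≡0 : ∣ a ∣ ≡ 0
    ∣a∣≡0 with ℕ.m*n≡0⇒m≡0∨n≡0 ∣ a ∣ (trans ∣a∣²≡5∣b∣² (cong (λ n → 5 ℕ.* (n ℕ.* n)) ∣b∣≡0))
    ... | inj₁ ∣a∣≡0 = ∣a∣≡0
    ... | inj₂ ∣a∣≡0 = ∣a∣≡0

  positive-trichotomy : ∀ α → Positive α ⊎ α ≡ 0ᴷ ⊎ Positive (⊝ α)
  positive-trichotomy (a + b √5) with <-cmp (+ 5 * (b * b)) (a * a)
  ... | tri≈ _ 5b²≡a² _ = inj₂ (inj₁ (5b²≡a²⇒0 5b²≡a²))
  ... | tri< 5b²<a² _ _ with <-cmp 0ℤ a
  ...   | tri< 0<a _ _ = inj₁ (re-dominant 0<a 5b²<a²)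
  ...   | tri≈ _ refl _ = ⊥-elim (<-irrefl refl (<-≤-trans 5b²<a² (0≤5square b)))
  ...   | tri> _ _ a<0 = inj₂ (inj₂ (re-dominant (neg-mono-< a<0)
                            (subst₂ _<_ (cong (+ 5 *_) (sym (neg-square b))) (sym (neg-square a)) 5b²<a²)))
  positive-trichotomy (a + b √5) | tri> _ _ a²<5b² with <-cmp 0ℤ b
  ...   | tri< 0<b _ _ = inj₁ (im-dominant 0<b a²<5b²)
  ...   | tri≈ _ refl _ = ⊥-elim (<-irrefl refl (<-≤-trans a²<5b² (0≤square a)))
  ...   | tri> _ _ b<0 = inj₂ (inj₂ (im-dominant (neg-mono-< b<0)
                            (subst₂ _<_ (sym (neg-square a)) (cong (+ 5 *_) (sym (neg-square b))) a²<5b²)))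

  -- (a c)² - (5 b d)² = (a² - 5 b²) c² + 5 b² (c² - 5 d²), and similarly for the other two cases.
  re-re-dominance : ∀ a b c d → 0ℤ < a → + 5 * (b * b) < a * a → 0ℤ < c → + 5 * (d * d) < c * c →
                    0ℤ < a * c - + 5 * (b * d) × 0ℤ < a * c + + 5 * (b * d)
  re-re-dominance a b c d 0<a 5b²<a² 0<c 5d²<c² = square-gap (a * c) (+ 5 * (b * d)) (0<* 0<a 0<c)
    (0<-⇒< (0<-≡ (gap-product (0≤5square b) 5b²<a² (0≤5square d) 5d²<c²) (solve (a ∷ b ∷ c ∷ d ∷ []))))

  im-im-dominance : ∀ a b c d → 0ℤ < b → a * a < + 5 * (b * b) → 0ℤ < d → c * c < + 5 * (d * d) →
                    0ℤ < + 5 * (b * d) - a * c × 0ℤ < + 5 * (b * d) + a * c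
  im-im-dominance a b c d 0<b a²<5b² 0<d c²<5d² =
    square-gap (+ 5 * (b * d)) (a * c) (0<* {+ 5} 0<+[1+ 4 ] (0<* 0<b 0<d))
      (0<-⇒< (0<-≡ (gap-product (0≤square a) a²<5b² (0≤square c) c²<5d²) (solve (a ∷ b ∷ c ∷ d ∷ []))))

  re-im-dominance : ∀ a b c d → 0ℤ < a → + 5 * (b * b) < a * a → 0ℤ < d → c * c < + 5 * (d * d) →
                    0ℤ < a * d + b * c
  re-im-dominance a b c d 0<a 5b²<a² 0<d c²<5d² = proj₂ (square-gap (a * d) (b * c) (0<* 0<a 0<d)
    (0<-⇒< (*-cancelˡ-<-nonNeg (+ 5) (0<-≡ (gap-product (0≤5square b) 5b²<a² (0≤square c) c²<5d²)
                                           (solve (a ∷ b ∷ c ∷ d ∷ []))))))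

  positive-⊗ : Positive α → Positive β → Positive (α ⊗ β)
  positive-⊗ (re-dominant {a} {b} 0<a 5b²<a²) (re-dominant {c} {d} 0<c 5d²<c²) =
    re-dominant (proj₂ (re-re-dominance a b c d 0<a 5b²<a² 0<c 5d²<c²))
      (0<-⇒< (0<-≡ (0<* (<⇒0<- 5b²<a²) (<⇒0<- 5d²<c²)) (solve (a ∷ b ∷ c ∷ d ∷ []))))
  positive-⊗ (re-dominant {a} {b} 0<a 5b²<a²) (im-dominant {c} {d} 0<d c²<5d²) =
    im-dominant (re-im-dominance a b c d 0<a 5b²<a² 0<d c²<5d²)
      (0<-⇒< (0<-≡ (0<* (<⇒0<- 5b²<a²) (<⇒0<- c²<5d²)) (solve (a ∷ b ∷ c ∷ d ∷ []))))
  positive-⊗ {α} {β} α>0@(im-dominant _ _) β>0@(re-dominant _ _) =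
    Positive-≡ (positive-⊗ β>0 α>0) (⊗-comm β α)
  positive-⊗ (im-dominant {a} {b} 0<b a²<5b²) (im-dominant {c} {d} 0<d c²<5d²) =
    re-dominant (0<-≡ (proj₂ (im-im-dominance a b c d 0<b a²<5b² 0<d c²<5d²)) (solve (a ∷ b ∷ c ∷ d ∷ [])))
      (0<-⇒< (0<-≡ (0<* (<⇒0<- a²<5b²) (<⇒0<- c²<5d²)) (solve (a ∷ b ∷ c ∷ d ∷ []))))

  ⊕-re-dominant : ∀ a b c d → 0ℤ < a → + 5 * (b * b) < a * a → 0ℤ < c → + 5 * (d * d) < c * c →
                  Positive ((a + b √5) ⊕ (c + d √5))
  ⊕-re-dominant a b c d 0<a 5b²<a² 0<c 5d²<c² = re-dominant (+-mono-< 0<a 0<c)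
    (0<-⇒< (0<-≡ (+-mono-< (+-mono-< (<⇒0<- 5b²<a²) (<⇒0<- 5d²<c²)) (+-mono-< gap gap))
                 (solve (a ∷ b ∷ c ∷ d ∷ []))))
    where gap = proj₁ (re-re-dominance a b c d 0<a 5b²<a² 0<c 5d²<c²)

  ⊕-im-dominant : ∀ a b c d → 0ℤ < b → a * a < + 5 * (b * b) → 0ℤ < d → c * c < + 5 * (d * d) →
                  Positive ((a + b √5) ⊕ (c + d √5))
  ⊕-im-dominant a b c d 0<b a²<5b² 0<d c²<5d² = im-dominant (+-mono-< 0<b 0<d)
    (0<-⇒< (0<-≡ (+-mono-< (+-mono-< (<⇒0<- a²<5b²) (<⇒0<- c²<5d²)) (+-mono-< gap gap))
                 (solve (a ∷ b ∷ c ∷ d ∷ []))))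
    where gap = proj₁ (im-im-dominance a b c d 0<b a²<5b² 0<d c²<5d²)

  -- In the mixed case, a negative α ⊕ β would share its dominant part with α or β.
  positive-⊕ : Positive α → Positive β → Positive (α ⊕ β)
  positive-⊕ (re-dominant {a} {b} 0<a 5b²<a²) (re-dominant {c} {d} 0<c 5d²<c²) =
    ⊕-re-dominant a b c d 0<a 5b²<a² 0<c 5d²<c²
  positive-⊕ (im-dominant {a} {b} 0<b a²<5b²) (im-dominant {c} {d} 0<d c²<5d²) =
    ⊕-im-dominant a b c d 0<b a²<5b² 0<d c²<5d²
  positive-⊕ {α} {β} α>0@(re-dominant {a} {b} 0<a 5b²<a²) β>0@(im-dominant {c} {d} 0<d c²<5d²)
    with positive-trichotomy (α ⊕ β)
  ... | inj₁ α⊕β>0 = α⊕β>0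
  ... | inj₂ (inj₁ α⊕β≡0) = ⊥-elim (positive-asym α>0 (Positive-≡ β>0
          (≡-by-parts (+≡0⇒≡- (cong re α⊕β≡0)) (+≡0⇒≡- (cong im α⊕β≡0)))))
    where
    +≡0⇒≡- : ∀ {i j} → i + j ≡ 0ℤ → j ≡ - i
    +≡0⇒≡- {i} {j} i+j≡0 = begin
      j          ≡⟨ solve (i ∷ j ∷ []) ⟩
      i + j - i  ≡⟨ cong (_- i) i+j≡0 ⟩
      0ℤ - i     ≡⟨ +-identityˡ (- i) ⟩
      - i        ∎
      where open ≡-Reasoning
  ... | inj₂ (inj₂ (re-dominant 0<e 5f²<e²)) = ⊥-elim (positive-asym β>0
          (Positive-≡ (⊕-re-dominant (- (a + c)) (- (b + d)) a b 0<e 5f²<e² 0<a 5b²<a²)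
                      (≡-by-parts (solve (a ∷ c ∷ [])) (solve (b ∷ d ∷ [])))))
  ... | inj₂ (inj₂ (im-dominant 0<f e²<5f²)) = ⊥-elim (positive-asym α>0
          (Positive-≡ (⊕-im-dominant (- (a + c)) (- (b + d)) c d 0<f e²<5f² 0<d c²<5d²)
                      (≡-by-parts (solve (a ∷ c ∷ [])) (solve (b ∷ d ∷ [])))))
  positive-⊕ {α} {β} α>0@(im-dominant _ _) β>0@(re-dominant _ _) =
    Positive-≡ (positive-⊕ β>0 α>0) (⊕-comm β α)

  nonneg-parts : ∀ {a b} → 0ℤ ≤ a → 0ℤ ≤ b → Positive (a + b √5) ⊎ a + b √5 ≡ 0ᴷ
  nonneg-parts {a} {b} 0≤a 0≤b with positive-trichotomy (a + b √5)
  ... | inj₁ α>0 = inj₁ α>0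
  ... | inj₂ (inj₁ α≡0) = inj₂ α≡0
  ... | inj₂ (inj₂ (re-dominant 0<-a _)) = ⊥-elim (<-irrefl refl (<-≤-trans (0<-⇒<0 0<-a) 0≤a))
  ... | inj₂ (inj₂ (im-dominant 0<-b _)) = ⊥-elim (<-irrefl refl (<-≤-trans (0<-⇒<0 0<-b) 0≤b))

  positive-im : ∀ {a b} → 0ℤ ≤ a → 0ℤ < b → Positive (a + b √5)
  positive-im 0≤a 0<b with nonneg-parts 0≤a (<⇒≤ 0<b)
  ... | inj₁ α>0 = α>0
  ... | inj₂ α≡0 = ⊥-elim (<-irrefl (sym (cong im α≡0)) 0<b)

  positive-⊕-nonneg : ∀ {a b} → Positive α → 0ℤ ≤ a → 0ℤ ≤ b → Positive (α ⊕ (a + b √5))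
  positive-⊕-nonneg {c + d √5} α>0 0≤a 0≤b with nonneg-parts 0≤a 0≤b
  ... | inj₁ β>0 = positive-⊕ α>0 β>0
  ... | inj₂ refl = Positive-≡ α>0 (≡-by-parts (sym (+-identityʳ c)) (sym (+-identityʳ d)))

  infix 4 _≺_
  _≺_ : ℤ[√5] → ℤ[√5] → Set
  α ≺ β = Positive (β ⊖ α)

  ≺-trans : α ≺ β → β ≺ γ → α ≺ γ
  ≺-trans {a + b √5} {c + d √5} {e + f √5} α≺β β≺γ =
    Positive-≡ (positive-⊕ β≺γ α≺β) (≡-by-parts (solve (a ∷ c ∷ e ∷ [])) (solve (b ∷ d ∷ f ∷ [])))

  ≺-cmp : ∀ α β → α ≺ β ⊎ α ≡ β ⊎ β ≺ α
  ≺-cmp α@(a + b √5) β@(c + d √5) with positive-trichotomy (β ⊖ α)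
  ... | inj₁ α≺β = inj₁ α≺β
  ... | inj₂ (inj₁ β-α≡0) =
    inj₂ (inj₁ (sym (≡-by-parts (i-j≡0⇒i≡j c a (cong re β-α≡0)) (i-j≡0⇒i≡j d b (cong im β-α≡0)))))
  ... | inj₂ (inj₂ β≺α) =
    inj₂ (inj₂ (Positive-≡ β≺α (≡-by-parts (solve (a ∷ c ∷ [])) (solve (b ∷ d ∷ [])))))

  ⊗-cancelʳ : α ⊗ γ ≡ β ⊗ γ → Positive γ → α ≡ β
  ⊗-cancelʳ {α} {γ} {β} αγ≡βγ γ>0 with ≺-cmp α β
  ... | inj₂ (inj₁ α≡β) = α≡β
  ... | inj₁ α≺β = ⊥-elim (¬positive-0 (Positive-≡ (positive-⊗ α≺β γ>0)
          (trans (⊗-distribʳ-⊖ β α γ) (trans (cong (β ⊗ γ ⊖_) αγ≡βγ) (⊖-self (β ⊗ γ))))))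
  ... | inj₂ (inj₂ β≺α) = ⊥-elim (¬positive-0 (Positive-≡ (positive-⊗ β≺α γ>0)
          (trans (⊗-distribʳ-⊖ α β γ) (trans (cong (_⊖ β ⊗ γ) αγ≡βγ) (⊖-self (β ⊗ γ))))))

  positive-±4 : Positive α → α ≡ ι (+ 4) ⊎ α ≡ ι (- + 4) → α ≡ ι (+ 4)
  positive-±4 _ (inj₁ α≡4) = α≡4
  positive-±4 α>0 (inj₂ refl) with ι-positive α>0
  ... | ()

  ≺-same-side : ∀ a b x → x ≢ b → ¬ (b ≺ x × x ≺ a) → x ≺ a → x ≺ b
  ≺-same-side a b x x≢b not-between x≺a with ≺-cmp x b
  ... | inj₁ x≺b = x≺b
  ... | inj₂ (inj₁ x≡b) = ⊥-elim (x≢b x≡b)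
  ... | inj₂ (inj₂ b≺x) = ⊥-elim (not-between (b≺x , x≺a))

  ≻-same-side : ∀ a b x → x ≢ b → ¬ (x ≺ b × a ≺ x) → a ≺ x → b ≺ x
  ≻-same-side a b x x≢b not-between a≺x with ≺-cmp x b
  ... | inj₁ x≺b = ⊥-elim (not-between (x≺b , a≺x))
  ... | inj₂ (inj₁ x≡b) = ⊥-elim (x≢b x≡b)
  ... | inj₂ (inj₂ b≺x) = b≺x

  -- (2 t - q) + q √5 ranges over the elements with even coordinate sum.
  between-0-and-4 : ∀ t q → let ρ = (+ 2 * t - q) + q √5 in
                    Positive ρ → Positive (ι (+ 4) ⊖ ρ) →
                    Positive (conj ρ) → Positive (ι (+ 4) ⊖ conj ρ) →
                    ρ ≡ ι (+ 2)
  between-0-and-4 t q ρ>0 ρ<4 ρ̄>0 ρ̄<4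
    -- (ρ + 4 - ρ̄) (ρ̄ + 4 - ρ) = 16 - 20 q²
    with 20i²<16⇒i≡0 {q} (0<-⇒< (ι-positive
           (Positive-≡ (positive-⊗ (positive-⊕ ρ>0 ρ̄<4) (positive-⊕ ρ̄>0 ρ<4))
                       (≡-by-parts (solve (t ∷ q ∷ [])) (solve (t ∷ q ∷ []))))))
  ... | refl with 0<2i<4⇒i≡1 {t}
      (subst (0ℤ <_) (+-identityʳ (+ 2 * t)) (ι-positive ρ>0))
      (0<-⇒< (subst (0ℤ <_) (cong (λ x → + 4 - x) (+-identityʳ (+ 2 * t))) (ι-positive ρ<4)))
  ...   | refl = refl

module BeattyReflection where

  open import Data.Nat using (z≤n; s≤s)
  open import Data.Integer
    using (ℤ; +_; 0ℤ; 1ℤ; -1ℤ; _+_; _*_; -_; _-_; _<_; _≤_; +<+; +≤+)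
  open import Data.Integer.Properties
    using ( +-mono-<; +-mono-≤; +-mono-<-≤; +-mono-≤-<; +-inverseʳ; +-identityˡ; neg-involutive
          ; *-cancelˡ-≡; *-cancelˡ-<-nonNeg; <-irrefl; <-trans; <⇒≤ )
  open import Data.Integer.Tactic.RingSolver using (solve)
  open import Data.List using (_∷_; [])
  open import Data.Product using (_×_; _,_; ∃-syntax)
  open import Data.Sum using (_⊎_; inj₁; inj₂; [_,_]′; map; swap)
  open import Function.Bundles using (_⇔_; mk⇔; Equivalence)
  open import Relation.Binary.PropositionalEquality
  open IntegerOrder
  open QuadraticIntegers

  -- θ k = 2 φ² k
  θ : ℤ → ℤ[√5]
  θ k = + 3 * k + k √5

  -- Rounds m k: m = ⌊φ² k + ½⌋, i.e. 2 m - 1 < 2 φ² k < 2 m + 1.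
  Rounds : ℤ → ℤ → Set
  Rounds m k = ι (+ 2 * m - 1ℤ) ≺ θ k × θ k ≺ ι (+ 2 * m + 1ℤ)

  θ-positive : ∀ j → Positive (θ j) → 0ℤ < j
  θ-positive j (re-dominant 0<3j _) = *-cancelˡ-<-nonNeg {0ℤ} {j} (+ 3) 0<3j
  θ-positive j (im-dominant 0<j _) = 0<j

  -- Used with f = F n and p = F (n - 1), so that f + p = F (n + 1), 2 f + p = F (n + 2) and
  -- f + 2 p is the Lucas number L n; then ε = L n - F n √5 has ε ε̄ = L n² - 5 F n² = ±4.
  module Reflection (f p : ℤ) (0<f : 0ℤ < f) (0<p : 0ℤ < p)
                    (cassini : f * f - f * p - p * p ≡ 1ℤ ⊎ f * f - f * p - p * p ≡ -1ℤ) where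

    ε ε̄ : ℤ[√5]
    ε = (f + + 2 * p) + (- f) √5
    ε̄ = (f + + 2 * p) + f √5

    ε⊗ε̄ : ε ⊗ ε̄ ≡ ι (- + 4 * (f * f - f * p - p * p))
    ε⊗ε̄ = ≡-by-parts (solve (f ∷ p ∷ [])) (solve (f ∷ p ∷ []))

    ε⊗ε̄≡±4 : ε ⊗ ε̄ ≡ ι (+ 4) ⊎ ε ⊗ ε̄ ≡ ι (- + 4)
    ε⊗ε̄≡±4 = [ (λ c≡1 → inj₂ (trans ε⊗ε̄ (cong (λ c → ι (- + 4 * c)) c≡1)))
               , (λ c≡-1 → inj₁ (trans ε⊗ε̄ (cong (λ c → ι (- + 4 * c)) c≡-1))) ]′ cassini

    lucas-margin : 0ℤ < + 2 * (f - 1ℤ) + + 4 * (p - 1ℤ) + 1ℤ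
    lucas-margin = +-mono-≤-< (+-mono-≤ (0≤* {+ 2} (+≤+ z≤n) (0<⇒0≤-1 0<f))
                                        (0≤* {+ 4} (+≤+ z≤n) (0<⇒0≤-1 0<p)))
                              0<+[1+ 0 ]

    1-ε-positive : Positive (ι 1ℤ ⊖ ε)
    1-ε-positive = im-dominant (0<-≡ 0<f (solve (f ∷ [])))
      (0<-⇒< (0<-≡ (+-mono-<-≤ lucas-margin margin) (solve (f ∷ p ∷ []))))
      where
      margin : 0ℤ ≤ + 4 * ((f * f - f * p - p * p) + 1ℤ)
      margin = [ (λ c≡1 → subst (λ c → 0ℤ ≤ + 4 * (c + 1ℤ)) (sym c≡1) (+≤+ z≤n))
               , (λ c≡-1 → subst (λ c → 0ℤ ≤ + 4 * (c + 1ℤ)) (sym c≡-1) (+≤+ z≤n)) ]′ cassini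

    1+ε-positive : Positive (ι 1ℤ ⊕ ε)
    1+ε-positive = re-dominant (+-mono-< 0<+[1+ 0 ] (+-mono-< 0<f (0<* {+ 2} 0<+[1+ 1 ] 0<p)))
      (0<-⇒< (0<-≡ (+-mono-<-≤ lucas-margin margin) (solve (f ∷ p ∷ []))))
      where
      margin : 0ℤ ≤ + 6 - + 4 * (f * f - f * p - p * p)
      margin = [ (λ c≡1 → subst (λ c → 0ℤ ≤ + 6 - + 4 * c) (sym c≡1) (+≤+ z≤n))
               , (λ c≡-1 → subst (λ c → 0ℤ ≤ + 6 - + 4 * c) (sym c≡-1) (+≤+ z≤n)) ]′ cassini

    ε⊕2j√5-positive : ∀ j → 0ℤ < j → Positive (ε ⊕ (0ℤ + (+ 2 * j) √5))
    ε⊕2j√5-positive j 0<j =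
      Positive-≡ (positive-⊕ 1+ε-positive
                   (positive-⊕-nonneg { -1ℤ + + 2 √5} (im-dominant 0<+[1+ 1 ] (+<+ (s≤s (s≤s z≤n))))
                     0≤0 (0≤* {+ 2} (+≤+ z≤n) (0<⇒0≤-1 0<j))))
                 (≡-by-parts (solve (f ∷ p ∷ [])) (solve (f ∷ j ∷ [])))

    ε̄-multiples : ∀ β → ∃[ t ] ∃[ q ] β ⊗ ε̄ ≡ (+ 2 * t - q) + q √5
    ε̄-multiples (x + z √5) =
      x * (f + p) + z * (+ 3 * f + p) , x * f + z * (f + + 2 * p) ,
      ≡-by-parts (solve (x ∷ z ∷ f ∷ p ∷ [])) (solve (x ∷ z ∷ f ∷ p ∷ []))

    -- 0 < β < δ and 0 < γ < ε̄, where δ ε̄ = ±4 and γ δ is the conjugate of β ε̄, put β ε̄ and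
    -- its conjugate into (0, 4); so β ε̄ = 2 and δ ε̄ = 4.
    small-gap⇒half : ∀ {β δ γ} → Positive β → Positive (δ ⊖ β) → Positive γ → Positive (ε̄ ⊖ γ) →
                     δ ⊗ ε̄ ≡ ι (+ 4) ⊎ δ ⊗ ε̄ ≡ ι (- + 4) → conj (β ⊗ ε̄) ≡ γ ⊗ δ →
                     β ⊕ β ≡ δ
    small-gap⇒half {β} {δ} {γ} β>0 δ-β>0 γ>0 ε̄-γ>0 δε̄≡±4 conj-βε̄≡γδ =
      ⊗-cancelʳ (trans (⊗-distribʳ-⊕ β β ε̄) (trans (cong₂ _⊕_ βε̄≡2 βε̄≡2) (sym δε̄≡4))) ε̄>0
      where
      ε̄>0 : Positive ε̄
      ε̄>0 = Positive-≡ (positive-⊕ ε̄-γ>0 γ>0) (⊖-⊕-cancel ε̄ γ)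
      δ>0 : Positive δ
      δ>0 = Positive-≡ (positive-⊕ δ-β>0 β>0) (⊖-⊕-cancel δ β)
      δε̄≡4 : δ ⊗ ε̄ ≡ ι (+ 4)
      δε̄≡4 = positive-±4 (positive-⊗ δ>0 ε̄>0) δε̄≡±4
      βε̄≡2 : β ⊗ ε̄ ≡ ι (+ 2)
      βε̄≡2 with ε̄-multiples β
      ... | t , q , βε̄≡ρ = trans βε̄≡ρ (between-0-and-4 t q
            (Positive-≡ (positive-⊗ β>0 ε̄>0) βε̄≡ρ)
            (Positive-≡ (positive-⊗ δ-β>0 ε̄>0)
                        (trans (⊗-distribʳ-⊖ δ β ε̄) (cong₂ _⊖_ δε̄≡4 βε̄≡ρ)))
            (Positive-≡ (positive-⊗ γ>0 δ>0) (trans (sym conj-βε̄≡γδ) (cong conj βε̄≡ρ)))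
            (Positive-≡ (positive-⊗ ε̄-γ>0 δ>0)
                        (trans (⊗-distribʳ-⊖ ε̄ γ δ)
                               (cong₂ _⊖_ (trans (⊗-comm ε̄ δ) δε̄≡4)
                                          (trans (sym conj-βε̄≡γδ) (cong conj βε̄≡ρ))))))

    doubled-gap≡ε⇒y≡H : ∀ y k → (ι y ⊖ θ k) ⊕ (ι y ⊖ θ k) ≡ ε → y ≡ + 2 * f + p
    doubled-gap≡ε⇒y≡H y k 2α≡ε = *-cancelˡ-≡ (+ 2) y (+ 2 * f + p) (begin
      + 2 * y                                                    ≡⟨ solve (y ∷ k ∷ []) ⟩
      ((y - + 3 * k) + (y - + 3 * k)) - + 3 * ((0ℤ - k) + (0ℤ - k))
        ≡⟨ cong₂ (λ r i → r - + 3 * i) (cong re 2α≡ε) (cong im 2α≡ε) ⟩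
      (f + + 2 * p) - + 3 * (- f)                                ≡⟨ solve (f ∷ p ∷ []) ⟩
      + 2 * (+ 2 * f + p)                                        ∎)
      where open ≡-Reasoning

    doubled-gap≡⊝ε⇒y≡H : ∀ y k → (θ k ⊖ ι y) ⊕ (θ k ⊖ ι y) ≡ ⊝ ε → y ≡ + 2 * f + p
    doubled-gap≡⊝ε⇒y≡H y k 2β≡-ε = *-cancelˡ-≡ (+ 2) y (+ 2 * f + p) (begin
      + 2 * y                                                    ≡⟨ solve (y ∷ k ∷ []) ⟩
      + 3 * ((k - 0ℤ) + (k - 0ℤ)) - ((+ 3 * k - y) + (+ 3 * k - y))
        ≡⟨ cong₂ (λ i r → + 3 * i - r) (cong im 2β≡-ε) (cong re 2β≡-ε) ⟩
      + 3 * (- - f) - (- (f + + 2 * p))                          ≡⟨ solve (f ∷ p ∷ []) ⟩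
      + 2 * (+ 2 * f + p)                                        ∎)
      where open ≡-Reasoning

    gap-above : ∀ y k → 0ℤ < k → k < f → ι y ⊖ ε ≺ θ k → θ k ≺ ι y → y ≡ + 2 * f + p
    gap-above y k 0<k k<f y-ε≺θk θk≺y = doubled-gap≡ε⇒y≡H y k
      (small-gap⇒half {ι y ⊖ θ k} {ε} {conj (ι y ⊖ θ k)} θk≺y ε-α>0
        (Positive-≡ (positive-⊕ θk≺y (positive-im 0≤0 (0<* {+ 2} 0<+[1+ 1 ] 0<k)))
                    (≡-by-parts (solve (y ∷ k ∷ [])) (solve (k ∷ []))))
        (Positive-≡ (positive-⊕ ε-α>0 (positive-im 0≤0 (0<* {+ 2} 0<+[1+ 1 ] (<⇒0<- k<f))))
                    (≡-by-parts (solve (y ∷ k ∷ f ∷ p ∷ [])) (solve (k ∷ f ∷ []))))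
        ε⊗ε̄≡±4 (conj-⊗ (ι y ⊖ θ k) ε̄))
      where
      ε-α>0 : Positive (ε ⊖ (ι y ⊖ θ k))
      ε-α>0 = Positive-≡ y-ε≺θk (≡-by-parts (solve (y ∷ k ∷ f ∷ p ∷ [])) (solve (k ∷ f ∷ [])))

    gap-below : ∀ y k → 0ℤ < k → k < f → ι y ≺ θ k → θ k ≺ ι y ⊖ ε → y ≡ + 2 * f + p
    gap-below y k 0<k k<f y≺θk θk≺y-ε = doubled-gap≡⊝ε⇒y≡H y k
      (small-gap⇒half {θ k ⊖ ι y} {⊝ ε} {conj (ι y ⊖ θ k)} y≺θk
        (Positive-≡ θk≺y-ε (≡-by-parts (solve (y ∷ k ∷ f ∷ p ∷ [])) (solve (k ∷ f ∷ []))))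
        (Positive-≡ (positive-⊕ θk≺y-ε (ε⊕2j√5-positive k 0<k))
                    (≡-by-parts (solve (y ∷ k ∷ f ∷ p ∷ [])) (solve (k ∷ f ∷ []))))
        (Positive-≡ (positive-⊕ y≺θk (ε⊕2j√5-positive (f - k) (<⇒0<- k<f)))
                    (≡-by-parts (solve (y ∷ k ∷ f ∷ p ∷ [])) (solve (k ∷ f ∷ []))))
        (map ⊝ε⊗ε̄ ⊝ε⊗ε̄ (swap ε⊗ε̄≡±4))
        (≡-by-parts (solve (y ∷ k ∷ f ∷ p ∷ [])) (solve (y ∷ k ∷ f ∷ p ∷ []))))
      where
      ⊝ε⊗ε̄ : ∀ {c} → ε ⊗ ε̄ ≡ ι c → ⊝ ε ⊗ ε̄ ≡ ⊝ ι c
      ⊝ε⊗ε̄ εε̄≡c = trans (⊝-⊗ ε ε̄) (cong ⊝_ εε̄≡c)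

    θ≢ι : ∀ k y → 0ℤ < k → θ k ≢ ι y
    θ≢ι k y 0<k θk≡y = <-irrefl (sym (cong im θk≡y)) 0<k

    θ≢ι-ε : ∀ k y → k < f → θ k ≢ ι y ⊖ ε
    θ≢ι-ε k y k<f θk≡y-ε = <-irrefl k≡f k<f
      where
      k≡f : k ≡ f
      k≡f = trans (cong im θk≡y-ε) (trans (+-identityˡ (- - f)) (neg-involutive f))

    Shifted : ℤ → ℤ → Set
    Shifted m k = ι (+ 2 * m - 1ℤ) ⊖ ε ≺ θ k × θ k ≺ ι (+ 2 * m + 1ℤ) ⊖ ε

    -- A gap would force 2 m ± 1 = 2 f + p, which is too small when m > f + p.
    rounds⇔shifted : ∀ m k → f + p < m → 0ℤ < k → k < f → Rounds m k ⇔ Shifted m k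
    rounds⇔shifted m k G<m 0<k k<f = mk⇔
      (λ (lo , hi) →
          ≻-same-side (ι y₁) (ι y₁ ⊖ ε) (θ k) (θ≢ι-ε k y₁ k<f)
                      (λ (θk≺ , ≺θk) → y₁≢H (gap-below y₁ k 0<k k<f ≺θk θk≺)) lo
        , ≺-same-side (ι y₂) (ι y₂ ⊖ ε) (θ k) (θ≢ι-ε k y₂ k<f)
                      (λ (≺θk , θk≺) → y₂≢H (gap-above y₂ k 0<k k<f ≺θk θk≺)) hi)
      (λ (lo , hi) →
          ≻-same-side (ι y₁ ⊖ ε) (ι y₁) (θ k) (θ≢ι k y₁ 0<k)
                      (λ (θk≺ , ≺θk) → y₁≢H (gap-above y₁ k 0<k k<f ≺θk θk≺)) lo
        , ≺-same-side (ι y₂ ⊖ ε) (ι y₂) (θ k) (θ≢ι k y₂ 0<k)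
                      (λ (≺θk , θk≺) → y₂≢H (gap-below y₂ k 0<k k<f ≺θk θk≺)) hi)
      where
      y₁ y₂ : ℤ
      y₁ = + 2 * m - 1ℤ
      y₂ = + 2 * m + 1ℤ
      0<m-G : 0ℤ < m - (f + p)
      0<m-G = <⇒0<- G<m
      H<y₁ : 0ℤ < (+ 2 * m - 1ℤ) - (+ 2 * f + p)
      H<y₁ = 0<-≡ (+-mono-<-≤ (+-mono-<-≤ 0<m-G (0<⇒0≤-1 0<m-G)) (<⇒≤ 0<p)) (solve (m ∷ f ∷ p ∷ []))
      H<y₂ : 0ℤ < (+ 2 * m + 1ℤ) - (+ 2 * f + p)
      H<y₂ = 0<-≡ (+-mono-< H<y₁ 0<+[1+ 1 ]) (solve (m ∷ f ∷ p ∷ []))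
      y₁≢H : y₁ ≢ + 2 * f + p
      y₁≢H y₁≡H = <-irrefl (sym (trans (cong (_- (+ 2 * f + p)) y₁≡H) (+-inverseʳ (+ 2 * f + p)))) H<y₁
      y₂≢H : y₂ ≢ + 2 * f + p
      y₂≢H y₂≡H = <-irrefl (sym (trans (cong (_- (+ 2 * f + p)) y₂≡H) (+-inverseʳ (+ 2 * f + p)))) H<y₂

    shifted⇔reflected : ∀ m k → Shifted m k ⇔ Rounds (+ 2 * f + p - m) (f - k)
    shifted⇔reflected m k = mk⇔
      (λ (lo , hi) → Positive-≡ hi (≡-by-parts (solve (m ∷ k ∷ f ∷ p ∷ [])) (solve (k ∷ f ∷ [])))
                   , Positive-≡ lo (≡-by-parts (solve (m ∷ k ∷ f ∷ p ∷ [])) (solve (k ∷ f ∷ []))))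
      (λ (lo , hi) → Positive-≡ hi (≡-by-parts (solve (m ∷ k ∷ f ∷ p ∷ [])) (solve (k ∷ f ∷ [])))
                   , Positive-≡ lo (≡-by-parts (solve (m ∷ k ∷ f ∷ p ∷ [])) (solve (k ∷ f ∷ []))))

    rounds⇒<f : ∀ m k → Rounds m k → m < + 2 * f + p → k < f
    rounds⇒<f m k (_ , θk≺) m<H = 0<-⇒< (θ-positive (f - k)
      (Positive-≡ (≺-trans {θ k} {ι (+ 2 * m + 1ℤ)} {θ f} θk≺ ≺θf)
                  (≡-by-parts (solve (k ∷ f ∷ [])) (solve (k ∷ f ∷ [])))))
      where
      ≺θf : ι (+ 2 * m + 1ℤ) ≺ θ f
      ≺θf = Positive-≡ (positive-⊕-nonneg 1-ε-positive
                                          (0≤* {+ 2} (+≤+ z≤n) (0<⇒0≤-1 (<⇒0<- m<H))) 0≤0)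
                       (≡-by-parts (solve (m ∷ f ∷ p ∷ [])) (solve (f ∷ [])))

    rounds-H : Rounds (+ 2 * f + p) f
    rounds-H = Positive-≡ 1-ε-positive (≡-by-parts (solve (f ∷ p ∷ [])) (solve (f ∷ [])))
             , Positive-≡ 1+ε-positive (≡-by-parts (solve (f ∷ p ∷ [])) (solve (f ∷ [])))

    rounds-reflection : ∀ m → f + p < m → m < + 2 * f + p →
                        (∃[ k ] 0ℤ < k × Rounds m k) ⇔ (∃[ k ] 0ℤ < k × Rounds (+ 2 * f + p - m) k)
    rounds-reflection m G<m m<H = mk⇔
      (λ (k , 0<k , r) → let k<f = rounds⇒<f m k r m<H in
         f - k , <⇒0<- k<f , to (shifted⇔reflected m k) (to (rounds⇔shifted m k G<m 0<k k<f) r))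
      (λ (k′ , 0<k′ , r′) → let k′<f = rounds⇒<f (+ 2 * f + p - m) k′ r′ H-m<H in
         f - k′ , <⇒0<- k′<f ,
         from (rounds⇔shifted m (f - k′) G<m (<⇒0<- k′<f) (0<-⇒< (0<-≡ 0<k′ (sym (f-[f-k]≡k k′)))))
              (from (shifted⇔reflected m (f - k′)) (subst (Rounds (+ 2 * f + p - m)) (sym (f-[f-k]≡k k′)) r′)))
      where
      open Equivalence
      f-[f-k]≡k : ∀ k → f - (f - k) ≡ k
      f-[f-k]≡k k = solve (f ∷ k ∷ [])
      H-m<H : + 2 * f + p - m < + 2 * f + p
      H-m<H = 0<-⇒< (0<-≡ (<-trans (+-mono-< 0<f 0<p) G<m) (solve (m ∷ f ∷ p ∷ [])))

module Sequence where

  open import Data.Nat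
  open import Data.Nat.Properties
  open import Data.Nat.Induction using (<-rec)
  open import Data.Product using (_×_; _,_; proj₁; proj₂; ∃-syntax)
  open import Data.Sum using (inj₁; inj₂)
  open import Data.Empty using (⊥-elim)
  open import Data.Bool using (true; false; T)
  open import Data.Unit using (tt)
  open import Function.Bundles using (_⇔_; mk⇔)
  open import Relation.Nullary using (yes; no; contradiction)
  open import Relation.Binary.PropositionalEquality

  fib-step : ∀ n → F n ≤ F (suc n)
  fib-step zero = z≤n
  fib-step (suc n) = m≤m+n (F (suc n)) (F n)

  fib-mono : ∀ {m n} → m ≤ n → F m ≤ F n
  fib-mono m≤n with m≤n⇒m<n∨m≡n m≤n
  ... | inj₂ refl = ≤-refl
  ... | inj₁ (s≤s {n = n} m≤n) = ≤-trans (fib-mono m≤n) (fib-step n)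

  fib-cancel-< : ∀ {m n} → F m < F n → m < n
  fib-cancel-< Fm<Fn = ≰⇒> (λ n≤m → <⇒≱ Fm<Fn (fib-mono n≤m))

  fib-index-≤ : ∀ m n → F (2 + m) < F (3 + n) → m ≤ n
  fib-index-≤ m n F<F = ≤-pred (≤-pred (≤-pred (fib-cancel-< {2 + m} {3 + n} F<F)))

  1≤fib : ∀ n → 1 ≤ F (suc n)
  1≤fib n = fib-mono {1} {suc n} (s≤s z≤n)

  fib-<-suc : ∀ i → F (2 + i) < F (3 + i)
  fib-<-suc i = m<m+n (F (2 + i)) (1≤fib i)

  i<fib : ∀ i → i < F (2 + i)
  i<fib zero = s≤s z≤n
  i<fib (suc i) = subst (_< F (3 + i)) (+-comm i 1) (+-mono-<-≤ {i} {F (2 + i)} (i<fib i) (1≤fib i))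

  record Block (i n : ℕ) : Set where
    constructor block
    field
      above : F (2 + i) < n
      below : n ≤ F (3 + i)

  block-of : ∀ n → 2 ≤ n → ∃[ i ] Block i n
  block-of (suc zero) (s≤s ())
  block-of (suc (suc zero)) _ = 0 , block ≤-refl ≤-refl
  block-of (suc (suc (suc n))) _ with block-of (suc (suc n)) (s≤s (s≤s z≤n))
  ... | i , block above below with m≤n⇒m<n∨m≡n below
  ...   | inj₁ n<F = i , block (≤-trans above (n≤1+n _)) n<F
  ...   | inj₂ n≡F = suc i , block (subst (_< 3 + n) n≡F (n<1+n _))
                                 (subst (λ x → suc x ≤ F (4 + i)) (sym n≡F) (m<m+n (F (3 + i)) (1≤fib (suc i))))

  findJ-block : ∀ {i n} fuel j → j ≤ 2 + i → 2 + i ∸ j < fuel → Block i n → findJ fuel j n ≡ 2 + i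
  findJ-block {i} {n} (suc fuel) j j≤ j<fuel b with n ≤ᵇ F (suc j) in found
  ... | true with m≤n⇒m<n∨m≡n j≤
  ...   | inj₂ j≡ = j≡
  ...   | inj₁ j< = contradiction (≤-trans (≤ᵇ⇒≤ n (F (suc j)) (subst T (sym found) tt)) (fib-mono j<))
                                  (<⇒≱ (Block.above b))
  findJ-block {i} {n} (suc fuel) j j≤ j<fuel b | false =
    findJ-block fuel (suc j) j< (<-≤-trans (∸-monoʳ-< (n<1+n j) j<) (≤-pred j<fuel)) b
    where
    j< : j < 2 + i
    j< = ≤∧≢⇒< j≤ (λ { refl → subst T found (≤⇒≤ᵇ (Block.below b)) })

  findJ-≥ : ∀ fuel j n → j ≤ findJ fuel j n
  findJ-≥ zero j n = ≤-refl
  findJ-≥ (suc fuel) j n with n ≤ᵇ F (suc j)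
  ... | true = ≤-refl
  ... | false = ≤-trans (n≤1+n j) (findJ-≥ fuel (suc j) n)

  ∸-< : ∀ m n → 0 < n → 0 < m → m ∸ n < m
  ∸-< (suc m) (suc n) _ _ = s≤s (m∸n≤m m n)

  aF-fuel : ∀ f g n → n < f → n < g → aF f n ≡ aF g n
  aF-fuel (suc f) (suc g) zero _ _ = refl
  aF-fuel (suc f) (suc g) (suc zero) _ _ = refl
  aF-fuel (suc f) (suc g) n@(suc (suc _)) (s≤s n≤f) (s≤s n≤g) =
    cong (F (suc j) ∸_) (aF-fuel f g (n ∸ F j) (<-≤-trans n-F<n n≤f) (<-≤-trans n-F<n n≤g))
    where
    j = findJ n 2 n
    n-F<n : n ∸ F j < n
    n-F<n = ∸-< n (F j) (fib-mono {1} {j} (≤-trans (s≤s z≤n) (findJ-≥ n 2 n))) (s≤s z≤n)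

  a-block : ∀ {i n} → Block i n → a n ≡ F (3 + i) ∸ a (n ∸ F (2 + i))
  a-block {i} {suc (suc m)} b
    rewrite findJ-block (suc (suc m)) 2 (s≤s (s≤s z≤n)) (<-trans (i<fib i) (Block.above b)) b =
    cong (F (3 + i) ∸_) (aF-fuel (suc (suc m)) (suc y) y
                                 (∸-< (suc (suc m)) (F (2 + i)) (1≤fib (suc i)) (s≤s z≤n)) (n<1+n y))
    where y = suc (suc m) ∸ F (2 + i)
  a-block {i} {suc zero} (block above _) = contradiction (1≤fib (suc i)) (<⇒≱ above)

  record Range (i n : ℕ) : Set where
    field
      lower  : F (2 + i) ≤ a n
      upper  : a n < F (3 + i)
      strict : 2 ≤ i → F (2 + i) < a n

  a-range : ∀ {i n} → Block i n → Range i n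
  a-range {n = n} = <-rec (λ n → ∀ {i} → Block i n → Range i n) step n
    where
    below-fib : ∀ {y} q → (∀ {y′} → y′ < suc y → ∀ {i} → Block i y′ → Range i y′) →
                1 ≤ y → y ≤ F (1 + q) → 1 ≤ a y × a y ≤ F (1 + q) × (2 ≤ q → a y < F (1 + q))
    below-fib {suc zero} q _ _ y≤F = ≤-refl , 1≤fib q , (λ 2≤q → fib-mono {3} {1 + q} (s≤s 2≤q))
    below-fib {suc (suc y)} q rec _ y≤F with block-of (suc (suc y)) (s≤s (s≤s z≤n))
    ... | i′ , b′ = ≤-trans (1≤fib (suc i′)) (Range.lower r) , <⇒≤ a<F , λ _ → a<F
      where
      r = rec ≤-refl b′
      a<F : a (suc (suc y)) < F (1 + q)
      a<F = <-≤-trans (Range.upper r)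
                      (fib-mono {3 + i′} {1 + q} (fib-cancel-< {2 + i′} (<-≤-trans (Block.above b′) y≤F)))

    step : ∀ n → (∀ {y} → y < n → ∀ {i} → Block i y → Range i y) → ∀ {i} → Block i n → Range i n
    step n rec {i} b@(block above below) = record
      { lower  = subst (F (2 + i) ≤_) (sym an≡) (subst (F (2 + i) ≤_) (sym (+-∸-assoc _ ay≤F))
                                                     (m≤m+n (F (2 + i)) (F (1 + i) ∸ a y)))
      ; upper  = subst (_< F (3 + i)) (sym an≡) (∸-< (F (3 + i)) (a y) 1≤ay (1≤fib (2 + i)))
      ; strict = λ 2≤i → subst (F (2 + i) <_) (sym an≡) (subst (F (2 + i) <_) (sym (+-∸-assoc _ ay≤F))
                                                     (m<m+n (F (2 + i)) (m<n⇒0<n∸m (ay<F 2≤i))))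
      }
      where
      y = n ∸ F (2 + i)
      an≡ : a n ≡ F (3 + i) ∸ a y
      an≡ = a-block b
      y<n : y < n
      y<n = ∸-< n (F (2 + i)) (1≤fib (suc i)) (≤-<-trans z≤n above)
      bounds = below-fib i (λ y′<1+y → rec (<-≤-trans y′<1+y y<n)) (m<n⇒0<n∸m above)
                         (subst (y ≤_) (m+n∸m≡n (F (2 + i)) (F (1 + i))) (∸-monoˡ-≤ (F (2 + i)) below))
      1≤ay = proj₁ bounds
      ay≤F = proj₁ (proj₂ bounds)
      ay<F = proj₂ (proj₂ bounds)

  a≢fib : ∀ i x → a x ≢ F (4 + i)
  a≢fib i zero = <⇒≢ (1≤fib (3 + i))
  a≢fib i (suc zero) = <⇒≢ (fib-mono {3} {4 + i} (s≤s (s≤s (s≤s z≤n))))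
  a≢fib i x@(suc (suc _)) with block-of x (s≤s (s≤s z≤n))
  ... | j , b with j ≤? suc i
  ...   | yes j≤1+i = <⇒≢ (<-≤-trans (Range.upper (a-range b)) (fib-mono {3 + j} {4 + i} (+-monoʳ-≤ 3 j≤1+i)))
  ...   | no j≰1+i = ≢-sym (<⇒≢ (≤-<-trans (fib-mono {4 + i} {2 + j} (+-monoʳ-≤ 2 (≰⇒> j≰1+i)))
                                           (Range.strict (a-range b) (≤-trans (s≤s (s≤s z≤n)) (≰⇒> j≰1+i)))))

  ∸-inverse : ∀ {c b m} → c ∸ b ≡ m → 0 < m → b ≡ c ∸ m
  ∸-inverse {c} {b} refl 0<c-b =
    sym (m∸[m∸n]≡n (<⇒≤ (≰⇒> λ c≤b → <⇒≢ 0<c-b (sym (m≤n⇒m∸n≡0 c≤b)))))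

  reflected-< : ∀ i {m} → F (3 + i) < m → m < F (4 + i) → F (4 + i) ∸ m < F (2 + i)
  reflected-< i {m} F<m m<F =
    subst (F (4 + i) ∸ m <_) (m+n∸m≡n (F (3 + i)) (F (2 + i))) (∸-monoʳ-< F<m (<⇒≤ m<F))

  a-reflection : ∀ i m → F (3 + i) < m → m < F (4 + i) →
                 (∃[ x ] a x ≡ m) ⇔ (∃[ y ] a y ≡ F (4 + i) ∸ m)
  a-reflection i m F<m m<F = mk⇔ to from
    where
    0<m′ : 0 < F (4 + i) ∸ m
    0<m′ = m<n⇒0<n∸m m<F
    m′<F : F (4 + i) ∸ m < F (2 + i)
    m′<F = reflected-< i F<m m<F

    to : ∃[ x ] a x ≡ m → ∃[ y ] a y ≡ F (4 + i) ∸ m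
    to (zero , refl) = ⊥-elim (<⇒≱ F<m z≤n)
    to (suc zero , refl) = ⊥-elim (<⇒≱ F<m (fib-mono {2} {3 + i} (s≤s (s≤s z≤n))))
    to (x@(suc (suc _)) , ax≡m) with block-of x (s≤s (s≤s z≤n))
    ... | j , b with ≤-antisym
      (fib-index-≤ j (suc i) (≤-<-trans (Range.lower (a-range b)) (subst (_< F (4 + i)) (sym ax≡m) m<F)))
      (fib-index-≤ (suc i) j (<-trans (subst (F (3 + i) <_) (sym ax≡m) F<m) (Range.upper (a-range b))))
    ...   | refl = x ∸ F (3 + i) , ∸-inverse (trans (sym (a-block b)) ax≡m) (≤-<-trans z≤n F<m)

    from : ∃[ y ] a y ≡ F (4 + i) ∸ m → ∃[ x ] a x ≡ m
    from (zero , ay≡m′) = ⊥-elim (<⇒≢ 0<m′ ay≡m′)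
    from (y@(suc _) , ay≡m′) = F (3 + i) + y , (begin-equality
      a (F (3 + i) + y)
        ≡⟨ a-block (block {suc i} (m<m+n (F (3 + i)) (s≤s z≤n)) (+-monoʳ-≤ (F (3 + i)) y≤F)) ⟩
      F (4 + i) ∸ a (F (3 + i) + y ∸ F (3 + i))  ≡⟨ cong (λ z → F (4 + i) ∸ a z) (m+n∸m≡n (F (3 + i)) y) ⟩
      F (4 + i) ∸ a y                            ≡⟨ cong (F (4 + i) ∸_) ay≡m′ ⟩
      F (4 + i) ∸ (F (4 + i) ∸ m)                ≡⟨ m∸[m∸n]≡n (<⇒≤ m<F) ⟩
      m                                          ∎)
      where
      open ≤-Reasoning
      y≤F : y ≤ F (2 + i)
      y≤F with y ≤? F (2 + i)
      ... | yes y≤F = y≤F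
      ... | no y≰F with block-of y (≤-trans (s≤s (1≤fib (suc i))) (≰⇒> y≰F))
      ...   | j , b = ⊥-elim (<⇒≱ m′<F (begin
        F (2 + i)      ≤⟨ fib-mono (+-monoʳ-≤ 2 (fib-index-≤ i j (<-≤-trans (≰⇒> y≰F) (Block.below b)))) ⟩
        F (2 + j)      ≤⟨ Range.lower (a-range b) ⟩
        a y            ≡⟨ ay≡m′ ⟩
        F (4 + i) ∸ m  ∎))

module BeattyFloor where

  open import Data.Nat as ℕ using (ℕ; zero; suc; z≤n; s≤s)
  import Data.Nat.Properties as ℕ
  open import Data.Integer as ℤ using (ℤ; +_; +0; +[1+_]; 0ℤ; 1ℤ; -1ℤ; _+_; _*_; -_; _-_; +<+; +≤+)
  open import Data.Integer.Properties
    using (pos-+; pos-*; ⊖-≥; m-n≡m⊖n; drop‿+<+; +-identityˡ; +-identityʳ)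
  open import Data.Integer.Tactic.RingSolver using (solve-∀)
  open import Data.Product using (_×_; _,_; ∃-syntax)
  open import Data.Sum using (_⊎_; inj₁; inj₂; map; swap)
  open import Data.Empty using (⊥-elim)
  open import Function.Bundles using (_⇔_; mk⇔; Equivalence)
  import Function.Properties.Equivalence as ⇔
  open import Relation.Nullary using (¬_; yes; no)
  open import Relation.Binary.PropositionalEquality
  open Irrationality using (x²≡5y²⇒y≡0)
  open IntegerOrder
  open QuadraticIntegers
  open BeattyReflection
  open Sequence using (1≤fib)
  open Equivalence

  cassini-step : ∀ x y → (x + y) * (x + y) - (x + y) * x - x * x ≡ - (x * x - x * y - y * y)
  cassini-step = solve-∀

  fib-cassini : ∀ n → let x = + F (suc n); y = + F n in
                x * x - x * y - y * y ≡ 1ℤ ⊎ x * x - x * y - y * y ≡ -1ℤ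
  fib-cassini zero = inj₁ refl
  fib-cassini (suc n) rewrite pos-+ (F (suc n)) (F n) =
    map (λ c≡-1 → trans (cassini-step (+ F (suc n)) (+ F n)) (cong -_ c≡-1))
        (λ c≡1 → trans (cassini-step (+ F (suc n)) (+ F n)) (cong -_ c≡1))
        (swap (fib-cassini n))

  +-∸ : ∀ m n → n ℕ.≤ m → + (m ℕ.∸ n) ≡ + m - + n
  +-∸ m n n≤m = trans (sym (⊖-≥ n≤m)) (sym (m-n≡m⊖n m n))

  +5k² : ∀ k → + (5 ℕ.* (k ℕ.* k)) ≡ + 5 * (+ k * + k)
  +5k² k = trans (pos-* 5 (k ℕ.* k)) (cong (+ 5 *_) (pos-* k k))

  0-square : ∀ x → (0ℤ - x) * (0ℤ - x) ≡ x * x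
  0-square = solve-∀

  +≮0 : ∀ {n} → ¬ (+ n ℤ.< 0ℤ)
  +≮0 (+<+ ())

  upper⇔ : ∀ k m → let x = 2 ℕ.* m ℕ.+ 1 ℕ.∸ 3 ℕ.* k in
           (3 ℕ.* k ℕ.< 2 ℕ.* m ℕ.+ 1 × 5 ℕ.* (k ℕ.* k) ℕ.< x ℕ.* x) ⇔ θ (+ k) ≺ ι (+ 2 * + m + 1ℤ)
  upper⇔ k m = mk⇔
    (λ (3k<y , 5k²<x²) → Positive-≡
      (re-dominant (+<+ (ℕ.m<n⇒0<n∸m 3k<y)) (subst₂ ℤ._<_ (5k²≡ k) (pos-* x x) (+<+ 5k²<x²)))
      (≡-by-parts (x≡ (ℕ.<⇒≤ 3k<y)) (sym (+-identityˡ (- + k)))))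
    (λ { (re-dominant 0<y-3k 5k²<re²) →
           let 3k<y = drop‿+<+ (subst₂ ℤ._<_ (sym (pos-* 3 k)) (sym y≡) (0<-⇒< 0<y-3k)) in
           3k<y , drop‿+<+ (subst₂ ℤ._<_
                    (trans (cong (+ 5 *_) (0-square (+ k))) (sym (+5k² k)))
                    (trans (cong₂ _*_ (sym (x≡ (ℕ.<⇒≤ 3k<y))) (sym (x≡ (ℕ.<⇒≤ 3k<y)))) (sym (pos-* x x)))
                    5k²<re²)
       ; (im-dominant 0<-k _) → ⊥-elim (+≮0 (0<-⇒<0 (subst (0ℤ ℤ.<_) (+-identityˡ (- + k)) 0<-k))) })
    where
    x = 2 ℕ.* m ℕ.+ 1 ℕ.∸ 3 ℕ.* k
    y≡ : + (2 ℕ.* m ℕ.+ 1) ≡ + 2 * + m + 1ℤ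
    y≡ = trans (pos-+ (2 ℕ.* m) 1) (cong (_+ 1ℤ) (pos-* 2 m))
    x≡ : 3 ℕ.* k ℕ.≤ 2 ℕ.* m ℕ.+ 1 → + x ≡ + 2 * + m + 1ℤ - + 3 * + k
    x≡ 3k≤y = trans (+-∸ _ _ 3k≤y) (cong₂ _-_ y≡ (pos-* 3 k))
    5k²≡ : ∀ k → + (5 ℕ.* (k ℕ.* k)) ≡ + 5 * (- + k * - + k)
    5k²≡ k = trans (+5k² k) (cong (+ 5 *_) (sym (neg-square (+ k))))

  +1-≡-[-1] : ∀ a b → a + 1ℤ - b ≡ a - (b - 1ℤ)
  +1-≡-[-1] = solve-∀

  -[-1]≡-[+1] : ∀ a b → a - (b - 1ℤ) ≡ - (b - (a + 1ℤ))
  -[-1]≡-[+1] = solve-∀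

  -- IsFloorPhi²k+½ states this half with ≤; equality is impossible for k ≥ 1 since √5 is irrational.
  lower⇔ : ∀ k m → 1 ℕ.≤ k → let z = 2 ℕ.* m ℕ.∸ (3 ℕ.* k ℕ.+ 1) in
           (2 ℕ.* m ℕ.≤ 3 ℕ.* k ℕ.+ 1 ⊎ z ℕ.* z ℕ.≤ 5 ℕ.* (k ℕ.* k)) ⇔
           ι (+ 2 * + m - 1ℤ) ≺ θ (+ k)
  lower⇔ k m 1≤k = mk⇔ to′ from′
    where
    z = 2 ℕ.* m ℕ.∸ (3 ℕ.* k ℕ.+ 1)
    w≡ : + (3 ℕ.* k ℕ.+ 1) ≡ + 3 * + k + 1ℤ
    w≡ = trans (pos-+ (3 ℕ.* k) 1) (cong (_+ 1ℤ) (pos-* 3 k))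
    re≡ : 2 ℕ.* m ℕ.≤ 3 ℕ.* k ℕ.+ 1 → + (3 ℕ.* k ℕ.+ 1 ℕ.∸ 2 ℕ.* m) ≡ + 3 * + k - (+ 2 * + m - 1ℤ)
    re≡ 2m≤w = trans (+-∸ _ _ 2m≤w)
                     (trans (cong₂ _-_ w≡ (pos-* 2 m)) (+1-≡-[-1] (+ 3 * + k) (+ 2 * + m)))
    -re≡ : 3 ℕ.* k ℕ.+ 1 ℕ.≤ 2 ℕ.* m → + 3 * + k - (+ 2 * + m - 1ℤ) ≡ - + z
    -re≡ w≤2m = trans (-[-1]≡-[+1] (+ 3 * + k) (+ 2 * + m))
                      (cong -_ (sym (trans (+-∸ _ _ w≤2m) (cong₂ _-_ (pos-* 2 m) w≡))))
    z²≡ : (- + z) * (- + z) ≡ + (z ℕ.* z)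
    z²≡ = trans (neg-square (+ z)) (sym (pos-* z z))
    z²≢5k² : z ℕ.* z ≢ 5 ℕ.* (k ℕ.* k)
    z²≢5k² z²≡5k² with x²≡5y²⇒y≡0 z k z²≡5k²
    ... | refl = ℕ.<⇒≱ 1≤k z≤n

    to′ : 2 ℕ.* m ℕ.≤ 3 ℕ.* k ℕ.+ 1 ⊎ z ℕ.* z ℕ.≤ 5 ℕ.* (k ℕ.* k) →
          ι (+ 2 * + m - 1ℤ) ≺ θ (+ k)
    to′ lower with 2 ℕ.* m ℕ.≤? 3 ℕ.* k ℕ.+ 1
    ... | yes 2m≤w =
      Positive-≡ (positive-im (+≤+ z≤n) (+<+ 1≤k)) (≡-by-parts (re≡ 2m≤w) (sym (+-identityʳ (+ k))))
    ... | no 2m≰w with lower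
    ...   | inj₁ 2m≤w = ⊥-elim (2m≰w 2m≤w)
    ...   | inj₂ z²≤5k² = Positive-≡
            (im-dominant (+<+ 1≤k)
                         (subst₂ ℤ._<_ (sym z²≡) (+5k² k) (+<+ (ℕ.≤∧≢⇒< z²≤5k² z²≢5k²))))
            (≡-by-parts (sym (-re≡ (ℕ.<⇒≤ (ℕ.≰⇒> 2m≰w)))) (sym (+-identityʳ (+ k))))

    from′ : ι (+ 2 * + m - 1ℤ) ≺ θ (+ k) →
            2 ℕ.* m ℕ.≤ 3 ℕ.* k ℕ.+ 1 ⊎ z ℕ.* z ℕ.≤ 5 ℕ.* (k ℕ.* k)
    from′ below with 2 ℕ.* m ℕ.≤? 3 ℕ.* k ℕ.+ 1
    ... | yes 2m≤w = inj₁ 2m≤w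
    ... | no 2m≰w with Positive-≡ below (≡-by-parts (-re≡ (ℕ.<⇒≤ (ℕ.≰⇒> 2m≰w))) (+-identityʳ (+ k)))
    ...   | re-dominant 0<-z _ = ⊥-elim (+≮0 (0<-⇒<0 0<-z))
    ...   | im-dominant _ z²<5k² = inj₂ (ℕ.<⇒≤ (drop‿+<+ (subst₂ ℤ._<_ z²≡ (sym (+5k² k)) z²<5k²)))

  isFloor⇔rounds : ∀ k m → 1 ℕ.≤ k → IsFloorPhi²k+½ k m ⇔ Rounds (+ m) (+ k)
  isFloor⇔rounds k m 1≤k = mk⇔
    (λ (lo , hi) → to (lower⇔ k m 1≤k) lo , to (upper⇔ k m) hi)
    (λ (lo , hi) → from (lower⇔ k m 1≤k) lo , from (upper⇔ k m) hi)

  Beatty : ℕ → Set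
  Beatty m = ∃[ k ] (1 ℕ.≤ k × IsFloorPhi²k+½ k m)

  beatty⇔rounds : ∀ m → Beatty m ⇔ (∃[ k ] 0ℤ ℤ.< k × Rounds (+ m) k)
  beatty⇔rounds m = mk⇔
    (λ (k , 1≤k , floor) → + k , +<+ 1≤k , to (isFloor⇔rounds k m 1≤k) floor)
    (λ { (+[1+ n ] , _ , r) → suc n , s≤s z≤n , from (isFloor⇔rounds (suc n) m (s≤s z≤n)) r
       ; (+0 , +<+ () , _) })

  +F[4+i]≡ : ∀ i → + F (4 ℕ.+ i) ≡ + 2 * + F (2 ℕ.+ i) + + F (1 ℕ.+ i)
  +F[4+i]≡ i = trans (pos-+ (F (3 ℕ.+ i)) (F (2 ℕ.+ i)))
                     (trans (cong (_+ + F (2 ℕ.+ i)) (pos-+ (F (2 ℕ.+ i)) (F (1 ℕ.+ i))))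
                            (f+p+f≡2f+p (+ F (2 ℕ.+ i)) (+ F (1 ℕ.+ i))))
    where
    f+p+f≡2f+p : ∀ f p → f + p + f ≡ + 2 * f + p
    f+p+f≡2f+p = solve-∀

  module FibReflection (i : ℕ) =
    Reflection (+ F (2 ℕ.+ i)) (+ F (1 ℕ.+ i)) (+<+ (1≤fib (1 ℕ.+ i))) (+<+ (1≤fib i)) (fib-cassini (1 ℕ.+ i))

  beatty-reflection : ∀ i m → F (3 ℕ.+ i) ℕ.< m → m ℕ.< F (4 ℕ.+ i) →
                      Beatty m ⇔ Beatty (F (4 ℕ.+ i) ℕ.∸ m)
  beatty-reflection i m F<m m<F =
    ⇔.trans (beatty⇔rounds m)
      (⇔.trans (rounds-reflection (+ m) (subst (ℤ._< + m) (pos-+ (F (2 ℕ.+ i)) (F (1 ℕ.+ i))) (+<+ F<m))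
                                        (subst (+ m ℤ.<_) (+F[4+i]≡ i) (+<+ m<F)))
               (⇔.sym (subst (λ m″ → Beatty m′ ⇔ (∃[ k ] 0ℤ ℤ.< k × Rounds m″ k))
                             +m′≡ (beatty⇔rounds m′))))
    where
    open FibReflection i
    m′ = F (4 ℕ.+ i) ℕ.∸ m
    +m′≡ : + m′ ≡ + 2 * + F (2 ℕ.+ i) + + F (1 ℕ.+ i) - + m
    +m′≡ = trans (+-∸ _ _ (ℕ.<⇒≤ m<F)) (cong (_- + m) (+F[4+i]≡ i))

  beatty-fib : ∀ i → Beatty (F (4 ℕ.+ i))
  beatty-fib i = from (beatty⇔rounds (F (4 ℕ.+ i)))
    (+ F (2 ℕ.+ i) , +<+ (1≤fib (1 ℕ.+ i)) ,
     subst (λ H → Rounds H (+ F (2 ℕ.+ i))) (sym (+F[4+i]≡ i)) rounds-H)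
    where open FibReflection i

open import Data.Nat using (ℕ; zero; suc; _+_; _*_; _∸_; _≤_; _<_; z≤n; s≤s; _≤?_)
open import Data.Nat.Properties
  using (≤-trans; ≤-antisym; <-trans; <⇒≤; ≰⇒>; <⇒≱; n≤1+n; m≤n⇒m<n∨m≡n; +-monoˡ-≤; *-monoʳ-≤)
open import Data.Nat.Induction using (<-rec)
open import Data.Product using (_×_; _,_; ∃-syntax)
open import Data.Sum using (inj₁; inj₂)
open import Data.Empty using (⊥; ⊥-elim)
open import Function.Bundles using (_⇔_; mk⇔)
import Function.Properties.Equivalence as ⇔
open import Function.Related.TypeIsomorphisms using (¬-cong-⇔)
open import Relation.Nullary using (¬_; yes; no)
open import Relation.Binary.PropositionalEquality using (_≡_; refl)
open Sequence
open BeattyFloor using (Beatty; beatty-reflection; beatty-fib)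

data Shape (m : ℕ) : Set where
  small   : m ≤ 2 → Shape m
  fib     : ∀ i → m ≡ F (4 + i) → Shape m
  between : ∀ i → F (3 + i) < m → m < F (4 + i) → Shape m

shape : ∀ m → Shape m
shape m with m ≤? 2
... | yes m≤2 = small m≤2
... | no m≰2 with block-of m (<⇒≤ (≰⇒> m≰2))
...   | zero , block _ m≤2 = ⊥-elim (m≰2 m≤2)
...   | suc i , block F<m m≤F with m≤n⇒m<n∨m≡n m≤F
...     | inj₁ m<F = between i F<m m<F
...     | inj₂ m≡F = fib i m≡F

small-attained : ∀ {m} → m ≤ 2 → ∃[ n ] a n ≡ m
small-attained z≤n = 0 , refl
small-attained (s≤s z≤n) = 1 , refl
small-attained (s≤s (s≤s z≤n)) = 3 , refl

¬beatty-small : ∀ {m} → m ≤ 2 → ¬ Beatty m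
¬beatty-small {m} m≤2 (k , 1≤k , _ , 3k<2m+1 , 5k²<x²) with k ≤? 1
... | no k≰1 = <⇒≱ (≤-trans 3k<2m+1 (+-monoˡ-≤ 1 (*-monoʳ-≤ 2 m≤2)))
                   (≤-trans (n≤1+n 5) (*-monoʳ-≤ 3 (≰⇒> k≰1)))
... | yes k≤1 with ≤-antisym k≤1 1≤k
...   | refl = witness-1-impossible m≤2 3k<2m+1 5k²<x²
  where
  witness-1-impossible : ∀ {m} → m ≤ 2 → 3 < 2 * m + 1 → 5 < (2 * m + 1 ∸ 3) * (2 * m + 1 ∸ 3) → ⊥
  witness-1-impossible z≤n (s≤s ())
  witness-1-impossible (s≤s z≤n) (s≤s (s≤s (s≤s ())))
  witness-1-impossible (s≤s (s≤s z≤n)) _ (s≤s (s≤s (s≤s (s≤s ()))))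

proposition5 : (m : ℕ) →
    (¬ (∃[ n ] a n ≡ m)) ⇔ (∃[ k ] (1 ≤ k × IsFloorPhi²k+½ k m))
proposition5 = <-rec _ step
  where
  step : ∀ m → (∀ {m′} → m′ < m → (¬ (∃[ n ] a n ≡ m′)) ⇔ Beatty m′) →
         (¬ (∃[ n ] a n ≡ m)) ⇔ Beatty m
  step m rec with shape m
  ... | small m≤2 =
    mk⇔ (λ missing → ⊥-elim (missing (small-attained m≤2))) (λ beatty → ⊥-elim (¬beatty-small m≤2 beatty))
  ... | fib i refl = mk⇔ (λ _ → beatty-fib i) (λ _ (x , ax≡F) → a≢fib i x ax≡F)
  ... | between i F<m m<F =
    ⇔.trans (¬-cong-⇔ (a-reflection i m F<m m<F))
      (⇔.trans (rec (<-trans (reflected-< i F<m m<F) (<-trans (fib-<-suc i) F<m)))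
               (⇔.sym (beatty-reflection i m F<m m<F)))
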